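{- Let $\mathbf{S4}$ (resp. $\mathbf{KD5}$, $\mathbf{B}$) be the class of pointed models in which every $R_a$ ($a\in A$) is reflexive and transitive (resp. serial and Euclidean; reflexive and symmetric). Then ${\leftrightarrows^\omega_{alt}}\cap\mathbf{S4}^2\not\subseteq{\leftrightarrows^2}\cap\mathbf{S4}^2$, ${\leftrightarrows^\omega_{alt}}\cap\mathbf{KD5}^2\not\subseteq{\leftrightarrows^2}\cap\mathbf{KD5}^2$, and ${\leftrightarrows^\omega_{alt}}\cap\mathbf{B}^2\not\subseteq{\leftrightarrows^2}\cap\mathbf{B}^2$. That is, for each of these three classes there are pointed models $\mathcal{M},u$ and $\mathcal{N},v$ in the class with $\mathcal{M},u\leftrightarrows^\omega_{alt}\mathcal{N},v$ but not $\mathcal{M},u\leftrightarrows^2\mathcal{N},v$.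
   Context: Fix a set $A$ of agents with $|A|\ge 2$ and a countably infinite set $\mathsf{Prop}$. Pointed models are Kripke models $\mathcal{M}=\langle W^{\mathcal{M}},\{R^{\mathcal{M}}_a\}_{a\in A},V^{\mathcal{M}}\rangle$ with a designated world; $V^{\mathcal{M}}(u)$ is the set of letters true at $u$. $\leftrightarrows^n$ is the usual $n$-bisimulation (atomic agreement plus back-and-forth along every $R_b$, $b\in A$, with $\leftrightarrows^{n-1}$ at the successors). Agent-alternating finite bisimulations, by induction on $n$: $\mathcal{M},u\leftrightarrows^0_{ -a}\mathcal{N},v$ iff $V^{\mathcal{M}}(u)=V^{\mathcal{N}}(v)$; $\mathcal{M},u\leftrightarrows^{n+1}_{ -a}\mathcal{N},v$ iff $V^{\mathcal{M}}(u)=V^{\mathcal{N}}(v)$ and for all $b\in A\setminus\{a\}$: every $x\in R^{\mathcal{M}}_b(u)$ has some $y\in R^{\mathcal{N}}_b(v)$ with $\mathcal{M},x\leftrightarrows^n_{ -b}\mathcal{N},y$, and every $y\in R^{\mathcal{N}}_b(v)$ has some $x\in R^{\mathcal{M}}_b(u)$ with $\mathcal{M},x\leftrightarrows^n_{ -b}\mathcal{N},y$. $\leftrightarrows^0_{alt}$ is like $\leftrightarrows^0_{ -a}$; $\leftrightarrows^{n+1}_{alt}$ is defined by the same conditions but for all $b\in A$. $\leftrightarrows^\omega_{alt}$ is the intersection of all $\leftrightarrows^n_{alt}$, $n\in\mathbb{N}$. -}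

module Defs where

open import Data.Nat using (ℕ; zero; suc)
open import Data.Product using (Σ; ∃; _×_; _,_)
open import Relation.Nullary using (¬_)
open import Relation.Binary.PropositionalEquality using (_≡_; _≢_)
open import Function.Bundles using (_⇔_)

record Model (A : Set) : Set₁ where
  field
    W : Set
    R : A → W → W → Set
    V : W → ℕ → Set
open Model public

module _ {A : Set} where

  AtomEq : (M N : Model A) → W M → W N → Set
  AtomEq M N u v = ∀ p → V M u p ⇔ V N v p

  Zig : (M N : Model A) → A → (W M → W N → Set) → W M → W N → Set
  Zig M N b Z u v =
    (∀ x → R M b u x → Σ (W N) λ y → R N b v y × Z x y) ×
    (∀ y → R N b v y → Σ (W M) λ x → R M b u x × Z x y)

  Bisim : ℕ → (M N : Model A) → W M → W N → Set
  Bisim zero    M N u v = AtomEq M N u v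
  Bisim (suc n) M N u v = AtomEq M N u v × (∀ b → Zig M N b (Bisim n M N) u v)

  BisimMinus : ℕ → A → (M N : Model A) → W M → W N → Set
  BisimMinus zero    a M N u v = AtomEq M N u v
  BisimMinus (suc n) a M N u v =
    AtomEq M N u v × (∀ b → b ≢ a → Zig M N b (BisimMinus n b M N) u v)

  BisimAlt : ℕ → (M N : Model A) → W M → W N → Set
  BisimAlt zero    M N u v = AtomEq M N u v
  BisimAlt (suc n) M N u v = AtomEq M N u v × (∀ b → Zig M N b (BisimMinus n b M N) u v)

  BisimAltω : (M N : Model A) → W M → W N → Set
  BisimAltω M N u v = ∀ n → BisimAlt n M N u v

  S4 : Model A → Set
  S4 M = ∀ a → (∀ w → R M a w w) × (∀ w x y → R M a w x → R M a x y → R M a w y)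

  KD5 : Model A → Set
  KD5 M = ∀ a → (∀ w → Σ (W M) λ x → R M a w x) ×
                (∀ w x y → R M a w x → R M a w y → R M a x y)

  B : Model A → Set
  B M = ∀ a → (∀ w → R M a w w) × (∀ w x → R M a w x → R M a x w)

  AltNotIn2 : (Model A → Set) → Set₁
  AltNotIn2 C =
    Σ (Model A) λ M → Σ (W M) λ u → Σ (Model A) λ N → Σ (W N) λ v →
      C M × C N × BisimAltω M N u v × ¬ Bisim 2 M N u v

-- The alternating game never lets agent a₁ move twice in a row, whereas the
-- 2-bisimulation game does: each counterexample is a pair of finite models whose
-- roots are separated by a formula ◇₁φ with φ of modal depth one in a₁ alone.
--
-- Equality of agents is not decidable, so a model over an arbitrary set A of agents
-- is obtained from a finite model with a relation R₁ for a₁ and a relation Rₒ shared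
-- by all other agents.  Its worlds are decision trees over the test "a = a₁": a
-- witness for an unknown agent a is a tree branching on a.  A tree denotes a finite
-- world only up to double negation, which is enough because every property of the
-- finite models that is transferred is decidable.  Alternating ω-bisimilarity of the
-- roots follows from two finite relations Z₁ and Zₒ (positions reached by a move of
-- a₁, resp. of another agent) that satisfy decidable zig-zag conditions, while a
-- 2-bisimulation would restrict to one between the R₁-reducts, which a computation
-- rules out.
module Submission where

open import Defs
open import Data.Bool using (Bool; T; _∧_; _∨_)
open import Data.Bool.ListAction using (any)
open import Data.Bool.Properties using (_≟_; T?; T-∧; T-∨; T-≡; ⇔→≡)
open import Data.Empty using (⊥-elim)
open import Data.Fin using (Fin; zero; toℕ)
open import Data.Fin.Properties using (all?; any?)
open import Data.List using (List; []; _∷_)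
open import Data.Nat using (ℕ; zero; suc; _≡ᵇ_)
open import Data.Product as Product using (Σ-syntax; ∃; _×_; _,_; proj₁; proj₂)
open import Data.Sum as Sum using (_⊎_; inj₁; inj₂)
open import Effect.Monad using (RawMonad)
open import Function using (_∘_; flip; Equivalence; mk⇔)
import Function.Properties.Equivalence as ⇔
open import Level using (0ℓ)
open import Relation.Binary.Definitions using (Reflexive; Transitive; Symmetric)
open import Relation.Binary.PropositionalEquality using (_≡_; _≢_; refl; sym; trans; subst)
open import Relation.Nullary using (¬_; Dec; yes; no)
open import Relation.Nullary.Decidable
  using (True; False; toWitness; toWitnessFalse; decidable-stable; map′; _×-dec_; _→-dec_;
         ¬¬-excluded-middle)
open import Relation.Nullary.Negation using (¬¬-Monad)

open RawMonad (¬¬-Monad {0ℓ}) using (_>>=_; _<$>_; pure)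

T-stable : ∀ {b} → ¬ ¬ T b → T b
T-stable = decidable-stable (T? _)

-- Alternating bisimulations

module _ {A : Set} {M N : Model A} where

  Zig-map : ∀ {b} {P Q : W M → W N → Set} → (∀ {x y} → P x y → Q x y) →
            ∀ {u v} → Zig M N b P u v → Zig M N b Q u v
  Zig-map f (forth , back) =
    (λ x r → let (y , r′ , p) = forth x r in y , r′ , f p) ,
    (λ y r → let (x , r′ , p) = back y r in x , r′ , f p)

  -- Z d relates the positions of the game in which agent d made the last move.
  record IsAltBisimulation (Z : A → W M → W N → Set) : Set where
    field
      atoms : ∀ {d x y} → Z d x y → AtomEq M N x y
      zig   : ∀ {d e x y} → e ≢ d → Z d x y → Zig M N e (Z e) x y

  module _ {Z : A → W M → W N → Set} (isAlt : IsAltBisimulation Z) where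
    open IsAltBisimulation isAlt

    altBisim⇒BisimMinus : ∀ n {d x y} → Z d x y → BisimMinus n d M N x y
    altBisim⇒BisimMinus zero    z = atoms z
    altBisim⇒BisimMinus (suc n) z =
      atoms z , λ e e≢d → Zig-map (altBisim⇒BisimMinus n) (zig e≢d z)

    altBisim⇒BisimAltω : ∀ {x y} → AtomEq M N x y → (∀ e → Zig M N e (Z e) x y) →
                         BisimAltω M N x y
    altBisim⇒BisimAltω at zigs zero    = at
    altBisim⇒BisimAltω at zigs (suc n) =
      at , λ e → Zig-map (altBisim⇒BisimMinus n) (zigs e)

-- Finite models with one relation for a₁ and one for all other agents

⟦_⟧ : {S S′ : Set} → (S → S′ → Bool) → S → S′ → Set
⟦ r ⟧ s t = T (r s t)

_∪_ : {S S′ : Set} → (S → S′ → Bool) → (S → S′ → Bool) → S → S′ → Bool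
(r ∪ r′) s t = r s t ∨ r′ s t

Serial : {S : Set} → (S → S → Set) → Set
Serial _∼_ = ∀ s → ∃ (s ∼_)

Euclidean : {S : Set} → (S → S → Set) → Set
Euclidean _∼_ = ∀ {s t u} → s ∼ t → s ∼ u → t ∼ u

BRel : ℕ → ℕ → Set
BRel m n = Fin m → Fin n → Bool

-- Agent a₁ moves along R₁ and every other agent along Rₒ; val is the truth value
-- of letter 0, all other letters being false.
record FinModel₂ : Set where
  field
    size  : ℕ
    R₁ Rₒ : BRel size size
    val   : Fin size → Bool
open FinModel₂

module _ {k : ℕ} (r : BRel k k) where

  reflexive? : Dec (Reflexive ⟦ r ⟧)
  reflexive? = map′ (λ h {s} → h s) (λ h s → h) (all? λ s → T? (r s s))

  symmetric? : Dec (Symmetric ⟦ r ⟧)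
  symmetric? = map′ (λ h {s} {t} → h s t) (λ h s t → h)
    (all? λ s → all? λ t → T? (r s t) →-dec T? (r t s))

  transitive? : Dec (Transitive ⟦ r ⟧)
  transitive? = map′ (λ h {s} {t} {u} → h s t u) (λ h s t u → h)
    (all? λ s → all? λ t → all? λ u → T? (r s t) →-dec T? (r t u) →-dec T? (r s u))

  euclidean? : Dec (Euclidean ⟦ r ⟧)
  euclidean? = map′ (λ h {s} {t} {u} → h s t u) (λ h s t u → h)
    (all? λ s → all? λ t → all? λ u → T? (r s t) →-dec T? (r s u) →-dec T? (r t u))

  serial? : Dec (Serial ⟦ r ⟧)
  serial? = all? λ s → any? λ t → T? (r s t)

  IsS4 IsKD5 IsB : Set
  IsS4  = Reflexive ⟦ r ⟧ × Transitive ⟦ r ⟧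
  IsKD5 = Serial ⟦ r ⟧ × Euclidean ⟦ r ⟧
  IsB   = Reflexive ⟦ r ⟧ × Symmetric ⟦ r ⟧

  isS4? : Dec IsS4
  isS4? = reflexive? ×-dec transitive?

  isKD5? : Dec IsKD5
  isKD5? = serial? ×-dec euclidean?

  isB? : Dec IsB
  isB? = reflexive? ×-dec symmetric?

Both : (∀ {k} → BRel k k → Set) → FinModel₂ → Set
Both P M = P (R₁ M) × P (Rₒ M)

both? : {P : ∀ {k} → BRel k k → Set} →
        (∀ {k} (r : BRel k k) → Dec (P r)) → ∀ M → Dec (Both P M)
both? P? M = P? (R₁ M) ×-dec P? (Rₒ M)

-- The answer t′ is fixed before the premises are known to hold, so that it can be
-- used for worlds that are only determined up to double negation.
Forth : ∀ {m n} → BRel m m → BRel n n → (src tgt : BRel m n) → Set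
Forth r r′ src tgt =
  ∀ t s′ → ∃ λ t′ → ∀ s → T (src s t) → T (r s s′) → T (r′ t t′ ∧ tgt s′ t′)

forth? : ∀ {m n} (r : BRel m m) (r′ : BRel n n) (src tgt : BRel m n) →
         Dec (Forth r r′ src tgt)
forth? r r′ src tgt = all? λ t → all? λ s′ → any? λ t′ → all? λ s →
  T? (src s t) →-dec T? (r s s′) →-dec T? (r′ t t′ ∧ tgt s′ t′)

record IsAltCertificate (M N : FinModel₂) (Z₁ Zₒ : BRel (size M) (size N)) : Set where
  field
    forth₁ : Forth (R₁ M) (R₁ N) Zₒ Z₁
    forthₒ : Forth (Rₒ M) (Rₒ N) (Z₁ ∪ Zₒ) Zₒ
    back₁  : Forth (R₁ N) (R₁ M) (flip Zₒ) (flip Z₁)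
    backₒ  : Forth (Rₒ N) (Rₒ M) (flip (Z₁ ∪ Zₒ)) (flip Zₒ)
    agree  : ∀ s t → T ((Z₁ ∪ Zₒ) s t) → val M s ≡ val N t

isAltCertificate? : ∀ M N Z₁ Zₒ → Dec (IsAltCertificate M N Z₁ Zₒ)
isAltCertificate? M N Z₁ Zₒ =
  map′ (λ (f₁ , fₒ , b₁ , bₒ , ag) →
          record { forth₁ = f₁ ; forthₒ = fₒ ; back₁ = b₁ ; backₒ = bₒ ; agree = ag })
       (λ c → let open IsAltCertificate c in forth₁ , forthₒ , back₁ , backₒ , agree)
       ( forth? (R₁ M) (R₁ N) Zₒ Z₁
   ×-dec forth? (Rₒ M) (Rₒ N) (Z₁ ∪ Zₒ) Zₒ
   ×-dec forth? (R₁ N) (R₁ M) (flip Zₒ) (flip Z₁)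
   ×-dec forth? (Rₒ N) (Rₒ M) (flip (Z₁ ∪ Zₒ)) (flip Zₒ)
   ×-dec all? λ s → all? λ t → T? ((Z₁ ∪ Zₒ) s t) →-dec val M s ≟ val N t)

isAltCertificate-flip : ∀ {M N Z₁ Zₒ} → IsAltCertificate M N Z₁ Zₒ →
                        IsAltCertificate N M (flip Z₁) (flip Zₒ)
isAltCertificate-flip c = record
  { forth₁ = back₁ ; forthₒ = backₒ ; back₁ = forth₁ ; backₒ = forthₒ
  ; agree = λ t s h → sym (agree s t h) }
  where open IsAltCertificate c

module _ (M N : FinModel₂) where

  Bisim₁ : ℕ → Fin (size M) → Fin (size N) → Set
  Bisim₁ zero    s t = val M s ≡ val N t
  Bisim₁ (suc k) s t = val M s ≡ val N t ×
    (∀ s′ → T (R₁ M s s′) → ∃ λ t′ → T (R₁ N t t′) × Bisim₁ k s′ t′) ×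
    (∀ t′ → T (R₁ N t t′) → ∃ λ s′ → T (R₁ M s s′) × Bisim₁ k s′ t′)

  bisim₁? : ∀ k s t → Dec (Bisim₁ k s t)
  bisim₁? zero    s t = val M s ≟ val N t
  bisim₁? (suc k) s t = val M s ≟ val N t
    ×-dec (all? λ s′ → T? (R₁ M s s′) →-dec any? λ t′ → T? (R₁ N t t′) ×-dec bisim₁? k s′ t′)
    ×-dec (all? λ t′ → T? (R₁ N t t′) →-dec any? λ s′ → T? (R₁ M s s′) ×-dec bisim₁? k s′ t′)

record Counterexample (P : ∀ {k} → BRel k k → Set) : Set₁ where
  field
    M N         : FinModel₂
    classM      : Both P M
    classN      : Both P N
    Z₁ Zₒ       : BRel (size M) (size N)
    certificate : IsAltCertificate M N Z₁ Zₒ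
    u           : Fin (size M)
    v           : Fin (size N)
    root        : T (Zₒ u v)
    separated   : ¬ Bisim₁ M N 2 u v

counterexample : {P : ∀ {k} → BRel k k → Set}
                 (P? : ∀ {k} (r : BRel k k) → Dec (P r)) →
                 (M N : FinModel₂) (Z₁ Zₒ : BRel (size M) (size N))
                 (u : Fin (size M)) (v : Fin (size N)) →
                 {True (both? P? M)} → {True (both? P? N)} →
                 {True (isAltCertificate? M N Z₁ Zₒ)} → {T (Zₒ u v)} →
                 {False (bisim₁? M N 2 u v)} → Counterexample P
counterexample P? M N Z₁ Zₒ u v {pM} {pN} {pc} {root} {separated} = record
  { M = M ; N = N ; classM = toWitness pM ; classN = toWitness pN
  ; Z₁ = Z₁ ; Zₒ = Zₒ ; certificate = toWitness pc
  ; u = u ; v = v ; root = root ; separated = toWitnessFalse separated }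

-- Lifting finite models to an arbitrary set of agents

module Lifting {A : Set} (a₁ : A) where

  ByAgent : A → Set → Set → Set
  ByAgent a P Q = (a ≡ a₁ → P) × (a ≢ a₁ → Q)

  module _ {a : A} {P Q P′ Q′ : Set} where

    byAgent-map : (P → P′) → (Q → Q′) → ByAgent a P Q → ByAgent a P′ Q′
    byAgent-map f g (p , q) = f ∘ p , g ∘ q

    byAgent-zipWith : ∀ {P″ Q″ : Set} → (P → P′ → P″) → (Q → Q′ → Q″) →
                      ByAgent a P Q → ByAgent a P′ Q′ → ByAgent a P″ Q″
    byAgent-zipWith f g (p , q) (p′ , q′) = (λ e → f (p e) (p′ e)) , (λ e → g (q e) (q′ e))

  byAgent-unzip : ∀ {a P Q P′ Q′} → ByAgent a (P × P′) (Q × Q′) →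
                  ByAgent a P Q × ByAgent a P′ Q′
  byAgent-unzip h = byAgent-map proj₁ proj₁ h , byAgent-map proj₂ proj₂ h

  agent-cases : ∀ {a} {X : Set} → (a ≡ a₁ → ¬ ¬ X) → (a ≢ a₁ → ¬ ¬ X) → ¬ ¬ X
  agent-cases f g = ¬¬-excluded-middle >>= λ where
    (yes e)  → f e
    (no ne) → g ne

  byAgent-⊎ : ∀ {a P Q} → ByAgent a P Q → ¬ ¬ (P ⊎ Q)
  byAgent-⊎ (p , q) = agent-cases (pure ∘ inj₁ ∘ p) (pure ∘ inj₂ ∘ q)

  data Tree (S : Set) : Set where
    leaf : S → Tree S
    node : A → Tree S → Tree S → Tree S

  module _ {S : Set} where

    infix 4 _⇓_
    _⇓_ : Tree S → S → Set
    leaf s     ⇓ t = s ≡ t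
    node a l r ⇓ t = ByAgent a (l ⇓ t) (r ⇓ t)

    ⇓-total : (x : Tree S) → ¬ ¬ ∃ (x ⇓_)
    ⇓-total (leaf s)     = pure (s , refl)
    ⇓-total (node a l r) = agent-cases
      (λ e  → do (s , l⇓s) ← ⇓-total l ; pure (s , (λ _ → l⇓s) , (λ ne → ⊥-elim (ne e))))
      (λ ne → do (s , r⇓s) ← ⇓-total r ; pure (s , (λ e → ⊥-elim (ne e)) , (λ _ → r⇓s)))

    ⇓-functional : ∀ x {s t} → x ⇓ s → x ⇓ t → ¬ ¬ s ≡ t
    ⇓-functional (leaf _)     refl refl = pure refl
    ⇓-functional (node a l r) (l⇓s , r⇓s) (l⇓t , r⇓t) = agent-cases
      (λ e  → ⇓-functional l (l⇓s e) (l⇓t e))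
      (λ ne → ⇓-functional r (r⇓s ne) (r⇓t ne))

  map : {S S′ : Set} → (S → S′) → Tree S → Tree S′
  map f (leaf s)     = leaf (f s)
  map f (node a l r) = node a (map f l) (map f r)

  map₂ : {S S′ U : Set} → (S → S′ → U) → Tree S → Tree S′ → Tree U
  map₂ f (leaf s)     y = map (f s) y
  map₂ f (node a l r) y = node a (map₂ f l y) (map₂ f r y)

  map-⇓ : {S S′ : Set} {f : S → S′} (x : Tree S) → ∀ {s u} →
          x ⇓ s → map f x ⇓ u → ¬ ¬ u ≡ f s
  map-⇓ (leaf _)     refl refl = pure refl
  map-⇓ (node a l r) (l⇓s , r⇓s) (l⇓u , r⇓u) = agent-cases
    (λ e  → map-⇓ l (l⇓s e) (l⇓u e))
    (λ ne → map-⇓ r (r⇓s ne) (r⇓u ne))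

  map₂-⇓ : {S S′ U : Set} {f : S → S′ → U} (x : Tree S) (y : Tree S′) → ∀ {s t u} →
           x ⇓ s → y ⇓ t → map₂ f x y ⇓ u → ¬ ¬ u ≡ f s t
  map₂-⇓ (leaf _)     y refl y⇓t xy⇓u = map-⇓ y y⇓t xy⇓u
  map₂-⇓ (node a l r) y (l⇓s , r⇓s) y⇓t (l⇓u , r⇓u) = agent-cases
    (λ e  → map₂-⇓ l y (l⇓s e) y⇓t (l⇓u e))
    (λ ne → map₂-⇓ r y (r⇓s ne) y⇓t (r⇓u ne))

  Lift : {S S′ : Set} → (S → S′ → Bool) → Tree S → Tree S′ → Set
  Lift r x y = ∀ {s t} → x ⇓ s → y ⇓ t → T (r s t)

  module _ {S S′ : Set} {r : S → S′ → Bool} where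

    Lift-flip : ∀ {x y} → Lift r x y → Lift (flip r) y x
    Lift-flip h y⇓t x⇓s = h x⇓s y⇓t

    Lift-leaf : ∀ {s t} → T (r s t) → Lift r (leaf s) (leaf t)
    Lift-leaf h refl refl = h

    Lift-nodeʳ : ∀ {a r′ x l l′} → ByAgent a (Lift r x l) (Lift r′ x l′) →
                 ByAgent a (Lift r x (node a l l′)) (Lift r′ x (node a l l′))
    Lift-nodeʳ (h , h′) =
      (λ e x⇓s (l⇓t , _) → h e x⇓s (l⇓t e)) ,
      (λ ne x⇓s (_ , l′⇓t) → h′ ne x⇓s (l′⇓t ne))

  ⇓-transport : ∀ {S} (x : Tree S) {p : S → Bool} {s s′} →
                x ⇓ s → T (p s) → x ⇓ s′ → T (p s′)
  ⇓-transport x {p} x⇓s ps x⇓s′ =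
    T-stable (do e ← ⇓-functional x x⇓s x⇓s′ ; pure (subst (T ∘ p) e ps))

  module _ {S : Set} {r : S → S → Bool} where

    Lift-reflexive : Reflexive ⟦ r ⟧ → ∀ x → Lift r x x
    Lift-reflexive ρ x {s} x⇓s = ⇓-transport x {r s} x⇓s ρ

    Lift-symmetric : Symmetric ⟦ r ⟧ → ∀ {x y} → Lift r x y → Lift r y x
    Lift-symmetric σ h y⇓t x⇓s = σ (h x⇓s y⇓t)

    Lift-transitive : Transitive ⟦ r ⟧ → ∀ {x} y {z} → Lift r x y → Lift r y z → Lift r x z
    Lift-transitive τ y h h′ x⇓s z⇓u =
      T-stable (do (t , y⇓t) ← ⇓-total y ; pure (τ (h x⇓s y⇓t) (h′ y⇓t z⇓u)))

    Lift-euclidean : Euclidean ⟦ r ⟧ → ∀ x {y z} → Lift r x y → Lift r x z → Lift r y z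
    Lift-euclidean ε x h h′ y⇓t z⇓u =
      T-stable (do (s , x⇓s) ← ⇓-total x ; pure (ε (h x⇓s y⇓t) (h′ x⇓s z⇓u)))

    Lift-map : ∀ {f : S → S} → (∀ s → T (r s (f s))) → ∀ x → Lift r x (map f x)
    Lift-map h x x⇓s fx⇓u =
      T-stable (do e ← map-⇓ x x⇓s fx⇓u ; pure (subst (⟦ r ⟧ _) (sym e) (h _)))

  Lift-forth : ∀ {m n} {r r′} {src tgt : BRel m n} (forth : Forth r r′ src tgt) →
               ∀ x y x′ → Lift src x y → Lift r x x′ →
               let y′ = map₂ (λ t s′ → proj₁ (forth t s′)) y x′
               in  Lift r′ y y′ × Lift tgt x′ y′
  Lift-forth {r′ = r′} {tgt = tgt} forth x y x′ src rel =
    (λ y⇓t y′⇓u → T-stable do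
       (s′ , x′⇓s′) ← ⇓-total x′
       proj₁ <$> answer y⇓t x′⇓s′ y′⇓u) ,
    (λ x′⇓s′ y′⇓u → T-stable do
       (t , y⇓t) ← ⇓-total y
       proj₂ <$> answer y⇓t x′⇓s′ y′⇓u)
    where
    answer : ∀ {t s′ u} → y ⇓ t → x′ ⇓ s′ →
             map₂ (λ t s′ → proj₁ (forth t s′)) y x′ ⇓ u → ¬ ¬ (T (r′ t u) × T (tgt s′ u))
    answer {t} {s′} y⇓t x′⇓s′ y′⇓u = do
      (s , x⇓s) ← ⇓-total x
      e ← map₂-⇓ y x′ y⇓t x′⇓s′ y′⇓u
      pure (Equivalence.to T-∧ (subst (λ u → T (r′ t u ∧ tgt s′ u)) (sym e)
                                  (proj₂ (forth t s′) s (src x⇓s y⇓t) (rel x⇓s x′⇓s′))))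

  liftModel : FinModel₂ → Model A
  liftModel M = record
    { W = Tree (Fin (size M))
    ; R = λ a x y → ByAgent a (Lift (R₁ M) x y) (Lift (Rₒ M) x y)
    ; V = λ x p → p ≡ 0 × (∀ {s} → x ⇓ s → T (val M s))
    }

  module _ (M : FinModel₂) where

    S4-liftModel : Both IsS4 M → S4 (liftModel M)
    S4-liftModel ((ρ₁ , τ₁) , (ρₒ , τₒ)) a =
      (λ x → (λ _ → Lift-reflexive {r = R₁ M} ρ₁ x) , (λ _ → Lift-reflexive {r = Rₒ M} ρₒ x)) ,
      (λ x y z → byAgent-zipWith (Lift-transitive {r = R₁ M} τ₁ y)
                                 (Lift-transitive {r = Rₒ M} τₒ y))

    B-liftModel : Both IsB M → B (liftModel M)
    B-liftModel ((ρ₁ , σ₁) , (ρₒ , σₒ)) a =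
      (λ x → (λ _ → Lift-reflexive {r = R₁ M} ρ₁ x) , (λ _ → Lift-reflexive {r = Rₒ M} ρₒ x)) ,
      (λ x y → byAgent-map (Lift-symmetric {r = R₁ M} σ₁) (Lift-symmetric {r = Rₒ M} σₒ))

    KD5-liftModel : Both IsKD5 M → KD5 (liftModel M)
    KD5-liftModel ((σ₁ , ε₁) , (σₒ , εₒ)) a =
      (λ x → node a (map (proj₁ ∘ σ₁) x) (map (proj₁ ∘ σₒ) x) ,
             Lift-nodeʳ ((λ _ → Lift-map {r = R₁ M} (proj₂ ∘ σ₁) x) ,
                         (λ _ → Lift-map {r = Rₒ M} (proj₂ ∘ σₒ) x))) ,
      (λ x y z → byAgent-zipWith (Lift-euclidean {r = R₁ M} ε₁ x)
                                 (Lift-euclidean {r = Rₒ M} εₒ x))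

  module Positions (M N : FinModel₂) (Z₁ Zₒ : BRel (size M) (size N)) where

    -- Alt d: agent d made the last move; Next e: agent e may make the next move.
    Alt Next : A → Tree (Fin (size M)) → Tree (Fin (size N)) → Set
    Alt  d x y = ByAgent d (Lift Z₁ x y) (Lift Zₒ x y)
    Next e x y = ByAgent e (Lift Zₒ x y) (Lift (Z₁ ∪ Zₒ) x y)

    Alt⇒Lift-∪ : ∀ {d x y} → Alt d x y → Lift (Z₁ ∪ Zₒ) x y
    Alt⇒Lift-∪ z x⇓s y⇓t = T-stable do
      h ← byAgent-⊎ z
      pure (Equivalence.from T-∨ (Sum.map (λ h₁ → h₁ x⇓s y⇓t) (λ hₒ → hₒ x⇓s y⇓t) h))

    Alt⇒Next : ∀ {d e x y} → e ≢ d → Alt d x y → Next e x y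
    Alt⇒Next e≢d z =
      (λ e≡a₁ → proj₂ z (λ d≡a₁ → e≢d (trans e≡a₁ (sym d≡a₁)))) , (λ _ → Alt⇒Lift-∪ z)

    Lift-∪ʳ : ∀ {x y} → Lift Zₒ x y → Lift (Z₁ ∪ Zₒ) x y
    Lift-∪ʳ h x⇓s y⇓t = Equivalence.from T-∨ (inj₂ (h x⇓s y⇓t))

    Next-root : ∀ {u v} → T (Zₒ u v) → ∀ e → Next e (leaf u) (leaf v)
    Next-root h e = (λ _ → Lift-leaf h) , (λ _ → Lift-∪ʳ (Lift-leaf h))

    atomEq : IsAltCertificate M N Z₁ Zₒ → ∀ {x y} → Lift (Z₁ ∪ Zₒ) x y →
             AtomEq (liftModel M) (liftModel N) x y
    atomEq c {x} {y} h p = mk⇔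
      (λ (p≡0 , holds) → p≡0 , λ {t} y⇓t → T-stable do
         (s , x⇓s) ← ⇓-total x
         pure (subst T (agree s t (h x⇓s y⇓t)) (holds x⇓s)))
      (λ (p≡0 , holds) → p≡0 , λ {s} x⇓s → T-stable do
         (t , y⇓t) ← ⇓-total y
         pure (subst T (sym (agree s t (h x⇓s y⇓t))) (holds y⇓t)))
      where open IsAltCertificate c

    forth-step : IsAltCertificate M N Z₁ Zₒ → ∀ {e x y x′} → Next e x y →
                 R (liftModel M) e x x′ →
                 Σ[ y′ ∈ Tree (Fin (size N)) ] R (liftModel N) e y y′ × Alt e x′ y′
    forth-step c {x = x} {y} {x′} next step =
      _ , Product.map Lift-nodeʳ Lift-nodeʳ (byAgent-unzip
            (byAgent-zipWith (Lift-forth forth₁ x y x′) (Lift-forth forthₒ x y x′) next step))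
      where open IsAltCertificate c

  module _ {M N : FinModel₂} {Z₁ Zₒ : BRel (size M) (size N)}
           (c : IsAltCertificate M N Z₁ Zₒ) where

    open Positions M N Z₁ Zₒ
    private module Converse = Positions N M (flip Z₁) (flip Zₒ)

    next-zig : ∀ {e x y} → Next e x y → Zig (liftModel M) (liftModel N) e (Alt e) x y
    next-zig next =
      (λ x′ → forth-step c next) ,
      (λ y′ step →
         let (x′ , step′ , z) = Converse.forth-step (isAltCertificate-flip c) (flipped next) step
         in  x′ , step′ , flipped z)
      where
      flipped : ∀ {S S′} {e} {r r′ : S → S′ → Bool} {x y} → ByAgent e (Lift r x y) (Lift r′ x y) →
                ByAgent e (Lift (flip r) y x) (Lift (flip r′) y x)
      flipped = byAgent-map Lift-flip Lift-flip

    isAltBisimulation : IsAltBisimulation Alt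
    isAltBisimulation = record
      { atoms = atomEq c ∘ Alt⇒Lift-∪
      ; zig   = λ e≢d → next-zig ∘ Alt⇒Next e≢d
      }

    certificate⇒BisimAltω : ∀ {u v} → T (Zₒ u v) →
                            BisimAltω (liftModel M) (liftModel N) (leaf u) (leaf v)
    certificate⇒BisimAltω root =
      altBisim⇒BisimAltω isAltBisimulation
        (atomEq c (Lift-∪ʳ (Lift-leaf root)))
        (λ e → next-zig (Next-root root e))

  a₁-successor : ∀ {M : FinModel₂} {x s s′} → x ⇓ s → T (R₁ M s s′) →
                 R (liftModel M) a₁ x (leaf s′)
  a₁-successor {x = x} x⇓s r =
    (λ _ x⇓s₀ → λ where refl → ⇓-transport x x⇓s r x⇓s₀) , (λ a₁≢a₁ → ⊥-elim (a₁≢a₁ refl))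

  module _ {M N : FinModel₂} where

    atomEq⇒val≡ : ∀ {x y s t} → AtomEq (liftModel M) (liftModel N) x y → x ⇓ s → y ⇓ t →
                  val M s ≡ val N t
    atomEq⇒val≡ {x} {y} {s} {t} ae x⇓s y⇓t =
      ⇔→≡ (⇔.trans (⇔.sym T-≡) (⇔.trans (mk⇔ to from) T-≡))
      where
      to : T (val M s) → T (val N t)
      to vs = proj₂ (Equivalence.to (ae 0) (refl , ⇓-transport x x⇓s vs)) y⇓t
      from : T (val N t) → T (val M s)
      from vt = proj₂ (Equivalence.from (ae 0) (refl , ⇓-transport y y⇓t vt)) x⇓s

    Bisim⇒Bisim₁ : ∀ k {x y s t} → Bisim k (liftModel M) (liftModel N) x y → x ⇓ s → y ⇓ t →
                   Bisim₁ M N k s t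
    Bisim⇒Bisim₁ zero    ae         x⇓s y⇓t = atomEq⇒val≡ ae x⇓s y⇓t
    Bisim⇒Bisim₁ (suc k) {x} {y} {s} {t} (ae , zigs) x⇓s y⇓t =
      atomEq⇒val≡ ae x⇓s y⇓t , forth , back
      where
      forth : ∀ s′ → T (R₁ M s s′) → ∃ λ t′ → T (R₁ N t t′) × Bisim₁ M N k s′ t′
      forth s′ r = decidable-stable (any? λ t′ → T? (R₁ N t t′) ×-dec bisim₁? M N k s′ t′) do
        let (y′ , y→y′ , b) = proj₁ (zigs a₁) (leaf s′) (a₁-successor {M = M} x⇓s r)
        (t′ , y′⇓t′) ← ⇓-total y′
        pure (t′ , proj₁ y→y′ refl y⇓t y′⇓t′ , Bisim⇒Bisim₁ k b refl y′⇓t′)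
      back : ∀ t′ → T (R₁ N t t′) → ∃ λ s′ → T (R₁ M s s′) × Bisim₁ M N k s′ t′
      back t′ r = decidable-stable (any? λ s′ → T? (R₁ M s s′) ×-dec bisim₁? M N k s′ t′) do
        let (x′ , x→x′ , b) = proj₂ (zigs a₁) (leaf t′) (a₁-successor {M = N} y⇓t r)
        (s′ , x′⇓s′) ← ⇓-total x′
        pure (s′ , proj₁ x→x′ refl x⇓s x′⇓s′ , Bisim⇒Bisim₁ k b x′⇓s′ refl)

  liftCounterexample : {P : ∀ {k} → BRel k k → Set} {C : Model A → Set} →
                       (∀ K → Both P K → C (liftModel K)) → Counterexample P → AltNotIn2 C
  liftCounterexample inC ce =
    liftModel M , leaf u , liftModel N , leaf v , inC M classM , inC N classN ,
    certificate⇒BisimAltω certificate root , separated ∘ λ b → Bisim⇒Bisim₁ 2 b refl refl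
    where open Counterexample ce

edges : ∀ {m n} → List (ℕ × ℕ) → BRel m n
edges es s t = any (λ (i , j) → (i ≡ᵇ toℕ s) ∧ (j ≡ᵇ toℕ t)) es

holdsAt : ∀ {k} → List ℕ → Fin k → Bool
holdsAt ws s = any (_≡ᵇ toℕ s) ws

-- ◇₁□₁¬p holds at M, 0 but not at N, 0.
s4-counterexample : Counterexample IsS4
s4-counterexample = counterexample isS4? M N Z₁ Zₒ zero zero
  where
  M N : FinModel₂
  M = record
    { size = 4
    ; R₁  = edges ((0 , 0) ∷ (0 , 3) ∷ (1 , 0) ∷ (1 , 1) ∷ (1 , 2) ∷
                   (1 , 3) ∷ (2 , 0) ∷ (2 , 2) ∷ (2 , 3) ∷ (3 , 3) ∷ [])
    ; Rₒ  = edges ((0 , 0) ∷ (1 , 1) ∷ (2 , 2) ∷ (2 , 3) ∷ (3 , 2) ∷ (3 , 3) ∷ [])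
    ; val = holdsAt (0 ∷ 1 ∷ [])
    }
  N = record
    { size = 4
    ; R₁  = edges ((0 , 0) ∷ (0 , 2) ∷ (0 , 3) ∷ (1 , 1) ∷ (2 , 0) ∷
                   (2 , 2) ∷ (2 , 3) ∷ (3 , 0) ∷ (3 , 2) ∷ (3 , 3) ∷ [])
    ; Rₒ  = edges ((0 , 0) ∷ (1 , 1) ∷ (1 , 2) ∷ (1 , 3) ∷ (2 , 1) ∷
                   (2 , 2) ∷ (2 , 3) ∷ (3 , 1) ∷ (3 , 2) ∷ (3 , 3) ∷ [])
    ; val = holdsAt (0 ∷ [])
    }
  Z₁ Zₒ : BRel 4 4
  Z₁ = edges ((0 , 0) ∷ (1 , 0) ∷ (2 , 1) ∷ (2 , 2) ∷ (2 , 3) ∷ (3 , 1) ∷ (3 , 2) ∷ (3 , 3) ∷ [])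
  Zₒ = edges ((0 , 0) ∷ (1 , 0) ∷ (2 , 2) ∷ (2 , 3) ∷ (3 , 1) ∷ [])

-- ◇₁◇₁p holds at N, 0 but not at M, 0.
kd5-counterexample : Counterexample IsKD5
kd5-counterexample = counterexample isKD5? M N Z₁ Zₒ zero zero
  where
  M N : FinModel₂
  M = record
    { size = 3
    ; R₁  = edges ((0 , 0) ∷ (1 , 1) ∷ (1 , 2) ∷ (2 , 1) ∷ (2 , 2) ∷ [])
    ; Rₒ  = edges ((0 , 0) ∷ (0 , 2) ∷ (1 , 1) ∷ (2 , 0) ∷ (2 , 2) ∷ [])
    ; val = holdsAt (1 ∷ [])
    }
  N = record
    { size = 4
    ; R₁  = edges ((0 , 2) ∷ (1 , 1) ∷ (1 , 2) ∷ (2 , 1) ∷ (2 , 2) ∷ (3 , 3) ∷ [])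
    ; Rₒ  = edges ((0 , 0) ∷ (0 , 2) ∷ (1 , 1) ∷ (2 , 0) ∷ (2 , 2) ∷ (3 , 3) ∷ [])
    ; val = holdsAt (1 ∷ [])
    }
  Z₁ Zₒ : BRel 3 4
  Z₁ = edges ((0 , 0) ∷ (0 , 2) ∷ (1 , 1) ∷ (2 , 0) ∷ (2 , 2) ∷ [])
  Zₒ = edges ((0 , 0) ∷ (1 , 1) ∷ (2 , 2) ∷ [])

-- ◇₁□₁¬p holds at M, 0 but not at N, 0.
b-counterexample : Counterexample IsB
b-counterexample = counterexample isB? M N Z₁ Zₒ zero zero
  where
  M N : FinModel₂
  M = record
    { size = 3
    ; R₁  = edges ((0 , 0) ∷ (0 , 1) ∷ (0 , 2) ∷ (1 , 0) ∷ (1 , 1) ∷ (2 , 0) ∷ (2 , 2) ∷ [])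
    ; Rₒ  = edges ((0 , 0) ∷ (0 , 2) ∷ (1 , 1) ∷ (2 , 0) ∷ (2 , 2) ∷ [])
    ; val = holdsAt (1 ∷ [])
    }
  N = record
    { size = 3
    ; R₁  = edges ((0 , 0) ∷ (0 , 1) ∷ (1 , 0) ∷ (1 , 1) ∷ (2 , 2) ∷ [])
    ; Rₒ  = edges ((0 , 0) ∷ (0 , 2) ∷ (1 , 1) ∷ (2 , 0) ∷ (2 , 2) ∷ [])
    ; val = holdsAt (1 ∷ [])
    }
  Z₁ Zₒ : BRel 3 3
  Z₁ = edges ((0 , 0) ∷ (0 , 2) ∷ (1 , 1) ∷ (2 , 0) ∷ (2 , 2) ∷ [])
  Zₒ = edges ((0 , 0) ∷ (1 , 1) ∷ (2 , 2) ∷ [])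

mainTheorem18 : (A : Set) (a₁ a₂ : A) → a₁ ≢ a₂ →
    AltNotIn2 {A} S4 × AltNotIn2 {A} KD5 × AltNotIn2 {A} B
mainTheorem18 A a₁ _ _ =
  liftCounterexample S4-liftModel s4-counterexample ,
  liftCounterexample KD5-liftModel kd5-counterexample ,
  liftCounterexample B-liftModel b-counterexample
  where open Lifting a₁
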